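{- Let $1\le k\le m$. The map $\mathcal{D}(m+1,k+1)\to\mathcal{B}(k,m-k,2)$, $w\mapsto B^w$, where $B^w$ is the $k\times(m-k)$ matrix with \[B^w_{ij}=\begin{cases}2 & \text{if } \mathrm{down}_{k+1-i}(w)\ge j,\\ 1 & \text{if } \mathrm{down}_{k+1-i}(w)<j \text{ and } \mathrm{up}_{k+1-i}(w)\ge j,\\ 0 & \text{if } \mathrm{up}_{k+1-i}(w)<j,\end{cases}\] is a well-defined bijection.
   Context: An $a\times b\times c$ plane partition is an $a\times b$ matrix of nonnegative integers bounded above by $c$ that is weakly decreasing along rows and columns; $\mathcal{B}(a,b,c)$ denotes the set of these. A Dyck word of length $2n$ is a string of $n$ letters $u$ and $n$ letters $d$ such that every initial substring contains at least as many $u$'s as $d$'s; a valley is an occurrence of the substring $du$. $\mathcal{D}(n,r)$ is the set of Dyck words of length $2n$ with exactly $r-1$ valleys. A letter of a Dyck word $w$ is central if it is neither the first nor the last letter of $w$ and it is not part of a valley of $w$. $\mathrm{up}_i(w)$ (resp. $\mathrm{down}_i(w)$) is the number of central $u$'s (resp. $d$'s) occurring before the $i$th valley of $w$; if $i$ exceeds the number of valleys of $w$, they are the total number of central $u$'s (resp. $d$'s) in $w$. -}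

module Defs where

open import Data.Nat using (ℕ; zero; suc; _+_; _*_; _∸_; _≤_; _<_; _≤ᵇ_; _<ᵇ_; _≡ᵇ_)
open import Data.Bool using (Bool; true; false; _∧_; _∨_; not; if_then_else_)
open import Data.List using (List; []; _∷_; length; filter; upTo; take)
open import Data.Vec using (Vec; lookup; tabulate)
open import Data.Fin using (Fin; toℕ; suc)
open import Data.Product using (_×_)
open import Relation.Binary.PropositionalEquality using (_≡_)
open import Relation.Nullary.Decidable using (Dec; yes; no)
open import Data.Maybe using (Maybe; just; nothing)

data Letter : Set where
  u d : Letter

isU : Letter → Bool
isU u = true
isU d = false

isD : Letter → Bool
isD l = not (isU l)

count : {A : Set} → (A → Bool) → List A → ℕ
count P [] = 0
count P (x ∷ xs) = if P x then suc (count P xs) else count P xs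

Word : Set
Word = List Letter

#u #d : Word → ℕ
#u [] = 0
#u (u ∷ w) = suc (#u w)
#u (d ∷ w) = #u w
#d [] = 0
#d (u ∷ w) = #d w
#d (d ∷ w) = suc (#d w)

record IsDyck (n : ℕ) (w : Word) : Set where
  field
    count-u  : #u w ≡ n
    count-d  : #d w ≡ n
    prefixes : ∀ i → #d (take i w) ≤ #u (take i w)

at : Word → ℕ → Maybe Letter
at [] p = nothing
at (x ∷ w) zero = just x
at (x ∷ w) (suc p) = at w p

isJustU isJustD : Maybe Letter → Bool
isJustU (just u) = true
isJustU _ = false
isJustD (just d) = true
isJustD _ = false

valleyStart : Word → ℕ → Bool
valleyStart w q = isJustD (at w q) ∧ isJustU (at w (suc q))

valleys : Word → ℕ
valleys w = count (λ q → valleyStart w q) (upTo (length w))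

inValley : Word → ℕ → Bool
inValley w zero = valleyStart w zero
inValley w (suc p) = valleyStart w (suc p) ∨ valleyStart w p

central : Word → ℕ → Bool
central w p = not (p ≡ᵇ 0) ∧ not (suc p ≡ᵇ length w) ∧ not (inValley w p)

valleysUpTo : Word → ℕ → ℕ
valleysUpTo w p = count (λ q → valleyStart w q) (upTo (suc p))

-- position p lies before the i-th valley (1-based i); if i exceeds the number
-- of valleys, every position counts
beforeValley : ℕ → Word → ℕ → Bool
beforeValley i w p = valleysUpTo w p <ᵇ i

InD : ℕ → ℕ → Word → Set
InD n r w = IsDyck n w × valleys w ≡ r ∸ 1

upᵢ downᵢ : ℕ → Word → ℕ
upᵢ i w = count (λ p → isJustU (at w p) ∧ central w p ∧ beforeValley i w p) (upTo (length w))
downᵢ i w = count (λ p → isJustD (at w p) ∧ central w p ∧ beforeValley i w p) (upTo (length w))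

Matrix : ℕ → ℕ → Set
Matrix a b = Vec (Vec ℕ b) a

entry : ∀ {a b} → Matrix a b → Fin a → Fin b → ℕ
entry M i j = lookup (lookup M i) j

record InB (a b c : ℕ) (M : Matrix a b) : Set where
  field
    bounded : ∀ i j → entry M i j ≤ c
    rowDec  : ∀ i (j j' : Fin b) → toℕ j ≤ toℕ j' → entry M i j' ≤ entry M i j
    colDec  : ∀ (i i' : Fin a) j → toℕ i ≤ toℕ i' → entry M i' j ≤ entry M i j

-- B^w, with 0-based Fin indices: row i ↔ 1-based i+1, so k+1-(i+1) = k - i;
-- column j ↔ 1-based j+1.
Bw : (k l : ℕ) → Word → Matrix k l
Bw k l w = tabulate λ i → tabulate λ j →
  let r = k ∸ toℕ i ; c = suc (toℕ j) in
  if c ≤ᵇ downᵢ r w then 2 else (if c ≤ᵇ upᵢ r w then 1 else 0)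

{-# OPTIONS --safe #-}
module Submission where

-- Every w in 𝒟(m+1,k+1) is a sequence of k+1 peaks u^(aᵣ+1) d^(bᵣ+1), and its central
-- letters are exactly the aᵣ inner u's and the bᵣ inner d's of each peak. Hence upᵣ(w) and
-- downᵣ(w) are the partial sums a₁+…+aᵣ and b₁+…+bᵣ, and row k+1-r of B^w consists of
-- downᵣ(w) 2's followed by 1's up to column upᵣ(w). The Dyck condition says exactly that
-- downᵣ ≤ upᵣ for every r, with both sums totalling m-k. Conversely, reading a plane
-- partition from its bottom row, the numbers of entries ≥ 1 and ≥ 2 in each row form two
-- weakly increasing sequences ending at m-k (once a row of 2's is added on top), with the
-- second one below the first; their increments are the run lengths of the unique preimage.

open import Defs
open import Data.Bool using (Bool; true; false; _∧_; not; if_then_else_; T)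
open import Data.Bool.Properties using (∧-zeroʳ; ∧-identityʳ)
open import Data.Empty using (⊥-elim)
open import Data.Fin using (Fin; toℕ; fromℕ<; zero; suc)
open import Data.Fin.Properties using (toℕ-fromℕ<; toℕ≤n)
open import Data.List using (List; []; _∷_; length; take; drop; _++_; _∷ʳ_; upTo; map; initLast; _∷ʳ′_)
open import Data.List.Properties using (map-upTo; take-all; take++drop≡id)
open import Data.Maybe using (Maybe; just; nothing)
open import Data.Nat using (ℕ; zero; suc; pred; _+_; _∸_; _⊓_; _≤_; _<_; _≤ᵇ_; _<ᵇ_; _≡ᵇ_; z≤n; s≤s; _<?_)
open import Data.Nat.Properties
open import Data.Nat.Tactic.RingSolver using (solve-∀)
open import Data.Product using (Σ-syntax; _×_; _,_; proj₁; proj₂)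
open import Data.Vec using (Vec; []; _∷_; lookup; tabulate; replicate)
open import Data.Vec.Properties using (lookup∘tabulate; tabulate∘lookup; tabulate-cong; lookup-replicate)
open import Function using (_∘_)
open import Relation.Binary.PropositionalEquality
open import Relation.Nullary using (yes; no; ¬_)
open import Relation.Nullary.Reflects using (ofʸ; ofⁿ)

sucIf : Bool → ℕ → ℕ
sucIf b n = if b then suc n else n

predIf : Bool → ℕ → ℕ
predIf b n = if b then pred n else n

onlyIf : Bool → ℕ → ℕ
onlyIf b n = if b then n else 0

sucIf-<ᵇ : ∀ b m n → (sucIf b m <ᵇ n) ≡ (m <ᵇ predIf b n)
sucIf-<ᵇ true  m zero    = refl
sucIf-<ᵇ true  m (suc n) = refl
sucIf-<ᵇ false m n       = refl

onlyIf-zero : ∀ b n → onlyIf b 0 + n ≡ n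
onlyIf-zero true  n = refl
onlyIf-zero false n = refl

sucIf-onlyIf : ∀ b m n → sucIf b (onlyIf b m + n) ≡ onlyIf b (suc m) + n
sucIf-onlyIf true  m n = refl
sucIf-onlyIf false m n = refl

≤ᵇ-true : ∀ {m n} → m ≤ n → (m ≤ᵇ n) ≡ true
≤ᵇ-true {m} {n} m≤n with m ≤ᵇ n | ≤ᵇ-reflects-≤ m n
... | true  | _       = refl
... | false | ofⁿ m≰n = ⊥-elim (m≰n m≤n)

≤ᵇ-false : ∀ {m n} → ¬ m ≤ n → (m ≤ᵇ n) ≡ false
≤ᵇ-false {m} {n} m≰n with m ≤ᵇ n | ≤ᵇ-reflects-≤ m n
... | true  | ofʸ m≤n = ⊥-elim (m≰n m≤n)
... | false | _       = refl

count-cong : ∀ {A : Set} {P Q : A → Bool} → (∀ x → P x ≡ Q x) → ∀ xs → count P xs ≡ count Q xs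
count-cong P≡Q []       = refl
count-cong {Q = Q} P≡Q (x ∷ xs) rewrite P≡Q x with Q x
... | true  = cong suc (count-cong P≡Q xs)
... | false = count-cong P≡Q xs

count-map : ∀ {A B : Set} (P : B → Bool) (f : A → B) xs → count P (map f xs) ≡ count (P ∘ f) xs
count-map P f []       = refl
count-map P f (x ∷ xs) with P (f x)
... | true  = cong suc (count-map P f xs)
... | false = count-map P f xs

count-upTo-suc : ∀ (P : ℕ → Bool) n → count P (upTo (suc n)) ≡ sucIf (P 0) (count (P ∘ suc) (upTo n))
count-upTo-suc P n =
  cong (sucIf (P 0)) (trans (cong (count P) (sym (map-upTo suc n))) (count-map P suc (upTo n)))

count-none : ∀ {A : Set} {P : A → Bool} → (∀ x → P x ≡ false) → ∀ xs → count P xs ≡ 0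
count-none P≡false []       = refl
count-none P≡false (x ∷ xs) rewrite P≡false x = count-none P≡false xs

count-mono : ∀ {A : Set} {P Q : A → Bool} → (∀ x → T (P x) → T (Q x)) → ∀ xs → count P xs ≤ count Q xs
count-mono P⇒Q []       = z≤n
count-mono {P = P} {Q} P⇒Q (x ∷ xs) with P x | Q x | P⇒Q x
... | true  | true  | _   = s≤s (count-mono P⇒Q xs)
... | true  | false | P⇒Q = ⊥-elim (P⇒Q _)
... | false | true  | _   = m≤n⇒m≤1+n (count-mono P⇒Q xs)
... | false | false | _   = count-mono P⇒Q xs

take-length-++ : ∀ {A : Set} (xs ys : List A) → take (length xs) (xs ++ ys) ≡ xs
take-length-++ []       ys = refl
take-length-++ (x ∷ xs) ys = cong (x ∷_) (take-length-++ xs ys)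

-- Run decomposition

ups dns : ℕ → Word → Word
ups zero    w = w
ups (suc a) w = u ∷ ups a w
dns zero    w = w
dns (suc b) w = d ∷ dns b w

ups-∷ : ∀ a w → ups a (u ∷ w) ≡ u ∷ ups a w
ups-∷ zero    w = refl
ups-∷ (suc a) w = cong (u ∷_) (ups-∷ a w)

dns-∷ : ∀ b w → dns b (d ∷ w) ≡ d ∷ dns b w
dns-∷ zero    w = refl
dns-∷ (suc b) w = cong (d ∷_) (dns-∷ b w)

ups-++ : ∀ a w v → ups a w ++ v ≡ ups a (w ++ v)
ups-++ zero    w v = refl
ups-++ (suc a) w v = cong (u ∷_) (ups-++ a w v)

dns-++ : ∀ b w v → dns b w ++ v ≡ dns b (w ++ v)
dns-++ zero    w v = refl
dns-++ (suc b) w v = cong (d ∷_) (dns-++ b w v)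

#u-ups : ∀ a w → #u (ups a w) ≡ a + #u w
#u-ups zero    w = refl
#u-ups (suc a) w = cong suc (#u-ups a w)

#u-dns : ∀ b w → #u (dns b w) ≡ #u w
#u-dns zero    w = refl
#u-dns (suc b) w = #u-dns b w

#d-ups : ∀ a w → #d (ups a w) ≡ #d w
#d-ups zero    w = refl
#d-ups (suc a) w = #d-ups a w

#d-dns : ∀ b w → #d (dns b w) ≡ b + #d w
#d-dns zero    w = refl
#d-dns (suc b) w = cong suc (#d-dns b w)

-- A block (a , b) is the peak u^(a+1) d^(b+1), whose central letters are a u's and b d's.
Runs : Set
Runs = List (ℕ × ℕ)

runsWord : Runs → Word
runsWord []            = []
runsWord ((a , b) ∷ R) = u ∷ ups a (dns (suc b) (runsWord R))

runLength : Letter → ℕ × ℕ → ℕ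
runLength u = proj₁
runLength d = proj₂

centrals : Letter → Runs → ℕ
centrals ℓ []       = 0
centrals ℓ (ab ∷ R) = runLength ℓ ab + centrals ℓ R

centrals-take-≤ : ∀ ℓ r R → centrals ℓ (take r R) ≤ centrals ℓ R
centrals-take-≤ ℓ zero    R        = z≤n
centrals-take-≤ ℓ (suc r) []       = z≤n
centrals-take-≤ ℓ (suc r) (ab ∷ R) = +-monoʳ-≤ (runLength ℓ ab) (centrals-take-≤ ℓ r R)

runsWord-++ : ∀ R S → runsWord (R ++ S) ≡ runsWord R ++ runsWord S
runsWord-++ []            S = refl
runsWord-++ ((a , b) ∷ R) S = cong (u ∷_) (begin
  ups a (dns (suc b) (runsWord (R ++ S)))        ≡⟨ cong (ups a ∘ dns (suc b)) (runsWord-++ R S) ⟩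
  ups a (dns (suc b) (runsWord R ++ runsWord S)) ≡⟨ cong (ups a) (sym (dns-++ (suc b) _ _)) ⟩
  ups a (dns (suc b) (runsWord R) ++ runsWord S) ≡⟨ sym (ups-++ a _ _) ⟩
  ups a (dns (suc b) (runsWord R)) ++ runsWord S ∎)
  where open ≡-Reasoning

#u-runsWord : ∀ R → #u (runsWord R) ≡ centrals u R + length R
#u-runsWord []            = refl
#u-runsWord ((a , b) ∷ R) = begin
  suc (#u (ups a (dns (suc b) (runsWord R)))) ≡⟨ cong suc (#u-ups a _) ⟩
  suc (a + #u (dns b (runsWord R)))           ≡⟨ cong (λ n → suc (a + n)) (#u-dns b _) ⟩
  suc (a + #u (runsWord R))                   ≡⟨ cong (λ n → suc (a + n)) (#u-runsWord R) ⟩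
  suc (a + (centrals u R + length R))         ≡⟨ suc-+-+ a _ _ ⟩
  a + centrals u R + suc (length R)           ∎
  where
  open ≡-Reasoning
  suc-+-+ : ∀ a c n → suc (a + (c + n)) ≡ a + c + suc n
  suc-+-+ = solve-∀

#d-runsWord : ∀ R → #d (runsWord R) ≡ centrals d R + length R
#d-runsWord []            = refl
#d-runsWord ((a , b) ∷ R) = begin
  #d (ups a (dns (suc b) (runsWord R))) ≡⟨ #d-ups a _ ⟩
  suc (#d (dns b (runsWord R)))         ≡⟨ cong suc (#d-dns b _) ⟩
  suc (b + #d (runsWord R))             ≡⟨ cong (λ n → suc (b + n)) (#d-runsWord R) ⟩
  suc (b + (centrals d R + length R))   ≡⟨ suc-+-+ b _ _ ⟩
  b + centrals d R + suc (length R)     ∎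
  where
  open ≡-Reasoning
  suc-+-+ : ∀ b c n → suc (b + (c + n)) ≡ b + c + suc n
  suc-+-+ = solve-∀

valleys-∷ : ∀ x w → valleys (x ∷ w) ≡ sucIf (valleyStart (x ∷ w) 0) (valleys w)
valleys-∷ x w = count-upTo-suc (valleyStart (x ∷ w)) (length w)

valleys-ups : ∀ a w → valleys (ups a w) ≡ valleys w
valleys-ups zero    w = refl
valleys-ups (suc a) w = trans (valleys-∷ u (ups a w)) (valleys-ups a w)

valleys-dns : ∀ b w → valleys (dns (suc b) w) ≡ valleys (d ∷ w)
valleys-dns zero    w = refl
valleys-dns (suc b) w = trans (valleys-∷ d (dns (suc b) w)) (valleys-dns b w)

valleys-runsWord : ∀ ab R → valleys (runsWord (ab ∷ R)) ≡ length R
valleys-runsWord (a , b) R = begin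
  valleys (ups (suc a) (dns (suc b) (runsWord R))) ≡⟨ valleys-ups (suc a) _ ⟩
  valleys (dns (suc b) (runsWord R))               ≡⟨ valleys-dns b _ ⟩
  valleys (d ∷ runsWord R)                         ≡⟨ valleys-d∷ R ⟩
  length R                                         ∎
  where
  open ≡-Reasoning
  valleys-d∷ : ∀ R → valleys (d ∷ runsWord R) ≡ length R
  valleys-d∷ []       = refl
  valleys-d∷ (ab ∷ R) = trans (valleys-∷ d (runsWord (ab ∷ R))) (cong suc (valleys-runsWord ab R))

isLetter : Letter → Maybe Letter → Bool
isLetter u = isJustU
isLetter d = isJustD

-- Centrality is local, so for a suffix w of a word only the letter prev preceding w
-- matters (nothing when w is the whole word).
centralAfter : Maybe Letter → Word → ℕ → Bool
centralAfter nothing  w p = central w p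
centralAfter (just x) w p = central (x ∷ w) (suc p)

counted : Letter → Maybe Letter → ℕ → Word → ℕ → Bool
counted ℓ prev n w p = isLetter ℓ (at w p) ∧ centralAfter prev w p ∧ (valleysUpTo w p <ᵇ n)

-- The central ℓ's of a suffix w lying before the n-th valley that starts inside w;
-- upᵢ i w and downᵢ i w are, by definition, centralCount u nothing i w and
-- centralCount d nothing i w.
centralCount : Letter → Maybe Letter → ℕ → Word → ℕ
centralCount ℓ prev n w = count (counted ℓ prev n w) (upTo (length w))

centralCount-zero : ∀ ℓ prev w → centralCount ℓ prev 0 w ≡ 0
centralCount-zero ℓ prev w = count-none (λ p →
  trans (cong (isLetter ℓ (at w p) ∧_) (∧-zeroʳ (centralAfter prev w p))) (∧-zeroʳ (isLetter ℓ (at w p))))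
  (upTo (length w))

centralCount-mono : ∀ ℓ prev w {n n'} → n ≤ n' → centralCount ℓ prev n w ≤ centralCount ℓ prev n' w
centralCount-mono ℓ prev w {n} n≤n' = count-mono (λ p →
  ∧∧-mono (isLetter ℓ (at w p)) (centralAfter prev w p) (λ v<n → <⇒<ᵇ (<-≤-trans (<ᵇ⇒< _ n v<n) n≤n')))
  (upTo (length w))
  where
  ∧∧-mono : ∀ a b {c c'} → (T c → T c') → T (a ∧ b ∧ c) → T (a ∧ b ∧ c')
  ∧∧-mono true true c⇒c' = c⇒c'

valleysUpTo-∷ : ∀ x w p → valleysUpTo (x ∷ w) (suc p) ≡ sucIf (valleyStart (x ∷ w) 0) (valleysUpTo w p)
valleysUpTo-∷ x w p = count-upTo-suc (valleyStart (x ∷ w)) (suc p)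

budget-∷ : ∀ n x w p →
  (valleysUpTo (x ∷ w) (suc p) <ᵇ n) ≡ (valleysUpTo w p <ᵇ predIf (valleyStart (x ∷ w) 0) n)
budget-∷ n x w p =
  trans (cong (_<ᵇ n) (valleysUpTo-∷ x w p)) (sucIf-<ᵇ (valleyStart (x ∷ w) 0) (valleysUpTo w p) n)

-- Both clauses hold by computation once prev is known: central (y ∷ x ∷ w) (2 + p)
-- unfolds to central (x ∷ w) (1 + p).
counted-∷ : ∀ ℓ prev n x w p →
  counted ℓ prev n (x ∷ w) (suc p) ≡ counted ℓ (just x) (predIf (valleyStart (x ∷ w) 0) n) w p
counted-∷ ℓ nothing  n x w p = cong (λ b → isLetter ℓ (at w p) ∧ central (x ∷ w) (suc p) ∧ b)
                                    (budget-∷ n x w p)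
counted-∷ ℓ (just y) n x w p = cong (λ b → isLetter ℓ (at w p) ∧ central (x ∷ w) (suc p) ∧ b)
                                    (budget-∷ n x w p)

centralCount-∷ : ∀ ℓ prev n x w → centralCount ℓ prev n (x ∷ w)
  ≡ sucIf (counted ℓ prev n (x ∷ w) 0) (centralCount ℓ (just x) (predIf (valleyStart (x ∷ w) 0) n) w)
centralCount-∷ ℓ prev n x w = trans (count-upTo-suc (counted ℓ prev n (x ∷ w)) (length w))
  (cong (sucIf (counted ℓ prev n (x ∷ w) 0)) (count-cong (counted-∷ ℓ prev n x w) (upTo (length w))))

-- In a block u u^a d^b d only the first and the last letter fail to be central: they start
-- or end the word, or belong to a valley.
module _ (ℓ : Letter) where

  counted-firstOfBlock : ∀ prev n v → isJustU prev ≡ false → counted ℓ prev n (u ∷ v) 0 ≡ false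
  counted-firstOfBlock nothing  n v _ = ∧-zeroʳ (isLetter ℓ (just u))
  counted-firstOfBlock (just d) n v _ =
    trans (cong (λ c → isLetter ℓ (just u) ∧ c ∧ (0 <ᵇ n)) (∧-zeroʳ (not (1 ≡ᵇ length (u ∷ v)))))
          (∧-zeroʳ (isLetter ℓ (just u)))

  counted-ascent : ∀ n a v → counted ℓ (just u) (suc n) (u ∷ ups a (d ∷ v)) 0 ≡ isLetter ℓ (just u)
  counted-ascent n zero    v = ∧-identityʳ (isLetter ℓ (just u))
  counted-ascent n (suc a) v = ∧-identityʳ (isLetter ℓ (just u))

  counted-descent : ∀ n x v → counted ℓ (just x) (suc n) (d ∷ d ∷ v) 0 ≡ isLetter ℓ (just d)
  counted-descent n u v = ∧-identityʳ (isLetter ℓ (just d))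
  counted-descent n d v = ∧-identityʳ (isLetter ℓ (just d))

  counted-lastOfBlock : ∀ n x R → counted ℓ (just x) (suc n) (d ∷ runsWord R) 0 ≡ false
  counted-lastOfBlock n x []      = ∧-zeroʳ (isLetter ℓ (just d))
  counted-lastOfBlock n x (_ ∷ _) = ∧-zeroʳ (isLetter ℓ (just d))

  centralCount-ups : ∀ n a v → centralCount ℓ (just u) (suc n) (ups a (d ∷ v))
    ≡ onlyIf (isLetter ℓ (just u)) a + centralCount ℓ (just u) (suc n) (d ∷ v)
  centralCount-ups n zero    v = sym (onlyIf-zero (isLetter ℓ (just u)) _)
  centralCount-ups n (suc a) v = begin
    centralCount ℓ (just u) (suc n) (u ∷ ups a (d ∷ v))
      ≡⟨ centralCount-∷ ℓ (just u) (suc n) u (ups a (d ∷ v)) ⟩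
    sucIf (counted ℓ (just u) (suc n) (u ∷ ups a (d ∷ v)) 0) (centralCount ℓ (just u) (suc n) (ups a (d ∷ v)))
      ≡⟨ cong₂ sucIf (counted-ascent n a v) (centralCount-ups n a v) ⟩
    sucIf (isLetter ℓ (just u)) (onlyIf (isLetter ℓ (just u)) a + centralCount ℓ (just u) (suc n) (d ∷ v))
      ≡⟨ sucIf-onlyIf (isLetter ℓ (just u)) a _ ⟩
    onlyIf (isLetter ℓ (just u)) (suc a) + centralCount ℓ (just u) (suc n) (d ∷ v) ∎
    where open ≡-Reasoning

  centralCount-lastOfBlock : ∀ n x R →
    centralCount ℓ (just x) (suc n) (d ∷ runsWord R) ≡ centralCount ℓ (just d) n (runsWord R)
  centralCount-lastOfBlock n x []       = cong (λ c → sucIf c 0) (counted-lastOfBlock n x [])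
  centralCount-lastOfBlock n x (ab ∷ R) = trans (centralCount-∷ ℓ (just x) (suc n) d (runsWord (ab ∷ R)))
    (cong (λ c → sucIf c (centralCount ℓ (just d) n (runsWord (ab ∷ R)))) (counted-lastOfBlock n x (ab ∷ R)))

  centralCount-dns : ∀ n x b R → centralCount ℓ (just x) (suc n) (dns (suc b) (runsWord R))
    ≡ onlyIf (isLetter ℓ (just d)) b + centralCount ℓ (just d) n (runsWord R)
  centralCount-dns n x zero    R =
    trans (centralCount-lastOfBlock n x R) (sym (onlyIf-zero (isLetter ℓ (just d)) _))
  centralCount-dns n x (suc b) R = begin
    centralCount ℓ (just x) (suc n) (d ∷ W)
      ≡⟨ centralCount-∷ ℓ (just x) (suc n) d W ⟩
    sucIf (counted ℓ (just x) (suc n) (d ∷ W) 0) (centralCount ℓ (just d) (suc n) W)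
      ≡⟨ cong₂ sucIf (counted-descent n x (dns b (runsWord R))) (centralCount-dns n d b R) ⟩
    sucIf (isLetter ℓ (just d)) (onlyIf (isLetter ℓ (just d)) b + centralCount ℓ (just d) n (runsWord R))
      ≡⟨ sucIf-onlyIf (isLetter ℓ (just d)) b _ ⟩
    onlyIf (isLetter ℓ (just d)) (suc b) + centralCount ℓ (just d) n (runsWord R) ∎
    where
    open ≡-Reasoning
    W : Word
    W = dns (suc b) (runsWord R)

  centralCount-block : ∀ prev n a b R → isJustU prev ≡ false →
    centralCount ℓ prev (suc n) (runsWord ((a , b) ∷ R))
      ≡ runLength ℓ (a , b) + centralCount ℓ (just d) n (runsWord R)
  centralCount-block prev n a b R prev≢u = begin
    centralCount ℓ prev (suc n) (u ∷ W)
      ≡⟨ centralCount-∷ ℓ prev (suc n) u W ⟩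
    sucIf (counted ℓ prev (suc n) (u ∷ W) 0) (centralCount ℓ (just u) (suc n) W)
      ≡⟨ cong (λ c → sucIf c (centralCount ℓ (just u) (suc n) W))
              (counted-firstOfBlock prev (suc n) W prev≢u) ⟩
    centralCount ℓ (just u) (suc n) (ups a (d ∷ dns b (runsWord R)))
      ≡⟨ centralCount-ups n a (dns b (runsWord R)) ⟩
    onlyIf (isLetter ℓ (just u)) a + centralCount ℓ (just u) (suc n) (dns (suc b) (runsWord R))
      ≡⟨ cong (onlyIf (isLetter ℓ (just u)) a +_) (centralCount-dns n u b R) ⟩
    onlyIf (isLetter ℓ (just u)) a + (onlyIf (isLetter ℓ (just d)) b + centralCount ℓ (just d) n (runsWord R))
      ≡⟨ onlyIf-runLength ℓ ⟩
    runLength ℓ (a , b) + centralCount ℓ (just d) n (runsWord R) ∎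
    where
    open ≡-Reasoning
    W : Word
    W = ups a (dns (suc b) (runsWord R))
    onlyIf-runLength : ∀ ℓ {r} → onlyIf (isLetter ℓ (just u)) a + (onlyIf (isLetter ℓ (just d)) b + r)
                                  ≡ runLength ℓ (a , b) + r
    onlyIf-runLength u = refl
    onlyIf-runLength d = refl

  centralCount-runsWord : ∀ prev n R → isJustU prev ≡ false →
    centralCount ℓ prev n (runsWord R) ≡ centrals ℓ (take n R)
  centralCount-runsWord prev zero    R             _      = centralCount-zero ℓ prev (runsWord R)
  centralCount-runsWord prev (suc n) []            _      = refl
  centralCount-runsWord prev (suc n) ((a , b) ∷ R) prev≢u = trans (centralCount-block prev n a b R prev≢u)
    (cong (runLength ℓ (a , b) +_) (centralCount-runsWord (just d) n R refl))

-- Dyck words as run sequences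

-- Every prefix of w has at most as many d's as u's, when w is preceded by x d's and y u's.
BallotFrom : ℕ → ℕ → Word → Set
BallotFrom x y w = ∀ i → x + #d (take i w) ≤ y + #u (take i w)

ballot-[] : ∀ {x y} → x ≤ y → BallotFrom x y []
ballot-[] x≤y zero    = +-monoˡ-≤ 0 x≤y
ballot-[] x≤y (suc i) = +-monoˡ-≤ 0 x≤y

ballot-u : ∀ {x y w} → x ≤ y → BallotFrom x (suc y) w → BallotFrom x y (u ∷ w)
ballot-u x≤y bal zero                = +-monoˡ-≤ 0 x≤y
ballot-u {x} {y} {w} x≤y bal (suc i) = subst (x + #d (take i w) ≤_) (sym (+-suc y _)) (bal i)

ballot-d : ∀ {x y w} → BallotFrom (suc x) y w → BallotFrom x y (d ∷ w)
ballot-d bal zero                = ≤-trans (n≤1+n _) (bal zero)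
ballot-d {x} {y} {w} bal (suc i) = subst (_≤ y + #u (take i w)) (sym (+-suc x _)) (bal i)

ballot-ups : ∀ a {x y w} → x ≤ y → BallotFrom x (a + y) w → BallotFrom x y (ups a w)
ballot-ups zero                x≤y bal = bal
ballot-ups (suc a) {x} {y} {w} x≤y bal = ballot-u x≤y
  (ballot-ups a (≤-trans x≤y (n≤1+n y)) (subst (λ z → BallotFrom x z w) (sym (+-suc a y)) bal))

ballot-dns : ∀ b {x y w} → BallotFrom (b + x) y w → BallotFrom x y (dns b w)
ballot-dns zero                bal = bal
ballot-dns (suc b) {x} {y} {w} bal = ballot-d (ballot-dns b (subst (λ z → BallotFrom z y w) (sym (+-suc b x)) bal))

ballot-runsWord : ∀ R x y → (∀ r → x + centrals d (take r R) ≤ y + centrals u (take r R)) →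
  BallotFrom x y (runsWord R)
ballot-runsWord []            x y bal = ballot-[] (+-cancelʳ-≤ 0 x y (bal 0))
ballot-runsWord ((a , b) ∷ R) x y bal =
  ballot-u x≤y (ballot-ups a (≤-trans x≤y (n≤1+n y)) (ballot-d (ballot-dns b
    (ballot-runsWord R (b + suc x) (a + suc y) λ r → subst₂ _≤_ (shift x b _) (shift y a _) (s≤s (bal (suc r)))))))
  where
  x≤y : x ≤ y
  x≤y = +-cancelʳ-≤ 0 x y (bal 0)
  shift : ∀ x b c → suc (x + (b + c)) ≡ b + suc x + c
  shift = solve-∀

-- runsWord (take r R) is a prefix of runsWord R.
ballot-blocks : ∀ R → BallotFrom 0 0 (runsWord R) → ∀ r → centrals d (take r R) ≤ centrals u (take r R)
ballot-blocks R bal r = +-cancelʳ-≤ (length X) _ _ (subst₂ _≤_ (#d-runsWord X) (#u-runsWord X)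
  (subst (λ v → #d v ≤ #u v) prefix (bal (length (runsWord X)))))
  where
  X : Runs
  X = take r R
  prefix : take (length (runsWord X)) (runsWord R) ≡ runsWord X
  prefix = begin
    take (length (runsWord X)) (runsWord R)
      ≡⟨ cong (take (length (runsWord X)) ∘ runsWord) (sym (take++drop≡id r R)) ⟩
    take (length (runsWord X)) (runsWord (X ++ drop r R))
      ≡⟨ cong (take (length (runsWord X))) (runsWord-++ X (drop r R)) ⟩
    take (length (runsWord X)) (runsWord X ++ runsWord (drop r R))
      ≡⟨ take-length-++ (runsWord X) _ ⟩
    runsWord X ∎
    where open ≡-Reasoning

mutual
  parseAscent : ∀ a v → Σ[ R ∈ Runs ] runsWord R ≡ u ∷ ups a (v ∷ʳ d)
  parseAscent a []      = ((a , 0) ∷ []) , refl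
  parseAscent a (u ∷ v) = let (R , eq) = parseAscent (suc a) v in
    R , trans eq (cong (u ∷_) (sym (ups-∷ a (v ∷ʳ d))))
  parseAscent a (d ∷ v) = parseDescent a 0 v

  parseDescent : ∀ a b v → Σ[ R ∈ Runs ] runsWord R ≡ u ∷ ups a (dns (suc b) (v ∷ʳ d))
  parseDescent a b []      = ((a , suc b) ∷ []) , cong (λ w → u ∷ ups a w) (sym (dns-∷ (suc b) []))
  parseDescent a b (d ∷ v) = let (R , eq) = parseDescent a (suc b) v in
    R , trans eq (cong (λ w → u ∷ ups a w) (sym (dns-∷ (suc b) (v ∷ʳ d))))
  parseDescent a b (u ∷ v) = let (R , eq) = parseAscent 0 v in
    ((a , b) ∷ R) , cong (λ w → u ∷ ups a (dns (suc b) w)) eq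

#u-∷ʳu : ∀ xs → #u (xs ∷ʳ u) ≡ suc (#u xs)
#u-∷ʳu []       = refl
#u-∷ʳu (u ∷ xs) = cong suc (#u-∷ʳu xs)
#u-∷ʳu (d ∷ xs) = #u-∷ʳu xs

#d-∷ʳu : ∀ xs → #d (xs ∷ʳ u) ≡ #d xs
#d-∷ʳu []       = refl
#d-∷ʳu (u ∷ xs) = #d-∷ʳu xs
#d-∷ʳu (d ∷ xs) = cong suc (#d-∷ʳu xs)

dyck-last≢u : ∀ {n} xs → ¬ IsDyck (suc n) (xs ∷ʳ u)
dyck-last≢u {n} xs D = 1+n≰n (subst₂ _≤_ #d≡1+n #u≡n prefix)
  where
  prefix : #d xs ≤ #u xs
  prefix = subst (λ v → #d v ≤ #u v) (take-length-++ xs (u ∷ [])) (IsDyck.prefixes D (length xs))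
  #d≡1+n : #d xs ≡ suc n
  #d≡1+n = trans (sym (#d-∷ʳu xs)) (IsDyck.count-d D)
  #u≡n : #u xs ≡ n
  #u≡n = suc-injective (trans (sym (#u-∷ʳu xs)) (IsDyck.count-u D))

dyck-runsWord : ∀ {n w} → IsDyck (suc n) w → Σ[ R ∈ Runs ] runsWord R ≡ w
dyck-runsWord {w = w} D with initLast w
... | []             = ⊥-elim (0≢1+n (IsDyck.count-u D))
... | xs ∷ʳ′ u       = ⊥-elim (dyck-last≢u xs D)
... | []       ∷ʳ′ d = ⊥-elim (1+n≰n (IsDyck.prefixes D 1))
... | (d ∷ xs) ∷ʳ′ d = ⊥-elim (1+n≰n (IsDyck.prefixes D 1))
... | (u ∷ xs) ∷ʳ′ d = parseAscent 0 xs

record DyckRuns (k l : ℕ) (R : Runs) : Set where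
  field
    blocks : length R ≡ suc k
    totals : ∀ ℓ → centrals ℓ R ≡ l
    ballot : ∀ r → centrals d (take r R) ≤ centrals u (take r R)

InD⇒DyckRuns : ∀ {k m w} → InD (suc m) (suc k) w → Σ[ R ∈ Runs ] runsWord R ≡ w × DyckRuns k (m ∸ k) R
InD⇒DyckRuns {k} {m} (D , valleys≡k) with dyck-runsWord D
... | [] , refl       = ⊥-elim (0≢1+n (IsDyck.count-u D))
... | (ab ∷ R) , refl = (ab ∷ R) , refl , record
  { blocks = cong suc length≡k
  ; totals = λ { u → total (trans (sym (#u-runsWord (ab ∷ R))) (IsDyck.count-u D))
               ; d → total (trans (sym (#d-runsWord (ab ∷ R))) (IsDyck.count-d D)) }
  ; ballot = ballot-blocks (ab ∷ R) (IsDyck.prefixes D)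
  }
  where
  length≡k : length R ≡ k
  length≡k = trans (sym (valleys-runsWord ab R)) valleys≡k
  total : ∀ {c} → c + suc (length R) ≡ suc m → c ≡ m ∸ k
  total {c} c+1+k≡1+m = trans (sym (m+n∸n≡m c k)) (cong (_∸ k) (suc-injective (begin
    suc (c + k)        ≡⟨ sym (+-suc c k) ⟩
    c + suc k          ≡⟨ cong (λ n → c + suc n) (sym length≡k) ⟩
    c + suc (length R) ≡⟨ c+1+k≡1+m ⟩
    suc m              ∎)))
    where open ≡-Reasoning

DyckRuns⇒InD : ∀ {k m R} → k ≤ m → DyckRuns k (m ∸ k) R → InD (suc m) (suc k) (runsWord R)
DyckRuns⇒InD {R = []}          k≤m DR = ⊥-elim (0≢1+n (DyckRuns.blocks DR))
DyckRuns⇒InD {k} {m} {ab ∷ R} k≤m DR =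
  record { count-u  = trans (#u-runsWord (ab ∷ R)) (total u)
         ; count-d  = trans (#d-runsWord (ab ∷ R)) (total d)
         ; prefixes = ballot-runsWord (ab ∷ R) 0 0 (DyckRuns.ballot DR) }
  , trans (valleys-runsWord ab R) (suc-injective (DyckRuns.blocks DR))
  where
  total : ∀ ℓ → centrals ℓ (ab ∷ R) + length (ab ∷ R) ≡ suc m
  total ℓ = begin
    centrals ℓ (ab ∷ R) + length (ab ∷ R) ≡⟨ cong₂ _+_ (DyckRuns.totals DR ℓ) (DyckRuns.blocks DR) ⟩
    m ∸ k + suc k                         ≡⟨ +-suc (m ∸ k) k ⟩
    suc (m ∸ k + k)                       ≡⟨ cong suc (m∸n+n≡m k≤m) ⟩
    suc m                                 ∎
    where open ≡-Reasoning

-- Rows of plane partitions with entries ≤ 2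

threshold : Letter → ℕ
threshold u = 1
threshold d = 2

-- Column c (counted from 1) of the row whose entries ≥ threshold ℓ are exactly its first N ℓ.
stepEntry : ℕ → (Letter → ℕ) → ℕ
stepEntry c N = if c ≤ᵇ N d then 2 else if c ≤ᵇ N u then 1 else 0

stepRow : (l : ℕ) → (Letter → ℕ) → Vec ℕ l
stepRow l N = tabulate λ j → stepEntry (suc (toℕ j)) N

stepRow-cong : ∀ {l N N'} → (∀ ℓ → N ℓ ≡ N' ℓ) → stepRow l N ≡ stepRow l N'
stepRow-cong N≡N' = tabulate-cong λ j →
  cong₂ (λ x y → if suc (toℕ j) ≤ᵇ x then 2 else if suc (toℕ j) ≤ᵇ y then 1 else 0) (N≡N' d) (N≡N' u)

stepEntry-≤2 : ∀ c N → stepEntry c N ≤ 2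
stepEntry-≤2 c N with c ≤ᵇ N d
... | true = ≤-refl
... | false with c ≤ᵇ N u
...   | true  = s≤s z≤n
...   | false = z≤n

stepEntry-mono : ∀ {c c' N N'} → c ≤ c' → (∀ ℓ → N' ℓ ≤ N ℓ) → stepEntry c' N' ≤ stepEntry c N
stepEntry-mono {c} {c'} {N} {N'} c≤c' N'≤N with c' ≤ᵇ N' d | ≤ᵇ-reflects-≤ c' (N' d)
... | true  | ofʸ c'≤N'd rewrite ≤ᵇ-true (≤-trans c≤c' (≤-trans c'≤N'd (N'≤N d))) = ≤-refl
... | false | _ with c' ≤ᵇ N' u | ≤ᵇ-reflects-≤ c' (N' u)
...   | false | _ = z≤n
...   | true  | ofʸ c'≤N'u rewrite ≤ᵇ-true (≤-trans c≤c' (≤-trans c'≤N'u (N'≤N u))) with c ≤ᵇ N d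
...     | true  = s≤s z≤n
...     | false = ≤-refl

stepEntry-threshold : ∀ ℓ c N → N d ≤ N u → (threshold ℓ ≤ᵇ stepEntry c N) ≡ (c ≤ᵇ N ℓ)
stepEntry-threshold u c N Nd≤Nu with c ≤ᵇ N d | ≤ᵇ-reflects-≤ c (N d)
... | true  | ofʸ c≤Nd = sym (≤ᵇ-true (≤-trans c≤Nd Nd≤Nu))
... | false | _ with c ≤ᵇ N u
...   | true  = refl
...   | false = refl
stepEntry-threshold d c N _ with c ≤ᵇ N d
... | true = refl
... | false with c ≤ᵇ N u
...   | true  = refl
...   | false = refl

prefixAtLeast : ∀ {l} → ℕ → Vec ℕ l → ℕ
prefixAtLeast t []       = 0
prefixAtLeast t (x ∷ xs) = if t ≤ᵇ x then suc (prefixAtLeast t xs) else 0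

Antitone : ∀ {l} → Vec ℕ l → Set
Antitone {l} v = ∀ (j j' : Fin l) → toℕ j ≤ toℕ j' → lookup v j' ≤ lookup v j

prefixAtLeast-unique : ∀ {l} t (v : Vec ℕ l) T → T ≤ l → (∀ j → (t ≤ᵇ lookup v j) ≡ (toℕ j <ᵇ T)) →
  prefixAtLeast t v ≡ T
prefixAtLeast-unique t []       zero    _         _ = refl
prefixAtLeast-unique t (x ∷ xs) zero    _         h rewrite h zero = refl
prefixAtLeast-unique t (x ∷ xs) (suc T) (s≤s T≤l) h rewrite h zero =
  cong suc (prefixAtLeast-unique t xs T T≤l (h ∘ suc))

prefixAtLeast-threshold : ∀ {l} t (v : Vec ℕ l) → Antitone v → ∀ j →
  (t ≤ᵇ lookup v j) ≡ (toℕ j <ᵇ prefixAtLeast t v)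
prefixAtLeast-threshold t (x ∷ xs) anti zero with t ≤ᵇ x
... | true  = refl
... | false = refl
prefixAtLeast-threshold t (x ∷ xs) anti (suc j) with t ≤ᵇ x | ≤ᵇ-reflects-≤ t x
... | true  | _       = prefixAtLeast-threshold t xs (λ j j' → anti (suc j) (suc j') ∘ s≤s) j
... | false | ofⁿ t≰x = ≤ᵇ-false (λ t≤xⱼ → t≰x (≤-trans t≤xⱼ (anti zero (suc j) z≤n)))

prefixAtLeast-d≤u : ∀ {l} (v : Vec ℕ l) → prefixAtLeast (threshold d) v ≤ prefixAtLeast (threshold u) v
prefixAtLeast-d≤u []                 = z≤n
prefixAtLeast-d≤u (zero        ∷ xs) = z≤n
prefixAtLeast-d≤u (suc zero    ∷ xs) = z≤n
prefixAtLeast-d≤u (suc (suc x) ∷ xs) = s≤s (prefixAtLeast-d≤u xs)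

prefixAtLeast-mono : ∀ {l} t (v v' : Vec ℕ l) → (∀ j → lookup v j ≤ lookup v' j) →
  prefixAtLeast t v ≤ prefixAtLeast t v'
prefixAtLeast-mono t []       []         v≤v' = z≤n
prefixAtLeast-mono t (x ∷ xs) (x' ∷ xs') v≤v' with t ≤ᵇ x | ≤ᵇ-reflects-≤ t x
... | false | _       = z≤n
... | true  | ofʸ t≤x rewrite ≤ᵇ-true (≤-trans t≤x (v≤v' zero)) =
  s≤s (prefixAtLeast-mono t xs xs' (v≤v' ∘ suc))

prefixAtLeast-stepRow : ∀ {l} N → N d ≤ N u → N u ≤ l → ∀ ℓ →
  prefixAtLeast (threshold ℓ) (stepRow l N) ≡ N ℓ
prefixAtLeast-stepRow {l} N Nd≤Nu Nu≤l ℓ = prefixAtLeast-unique (threshold ℓ) (stepRow l N) (N ℓ) (bound ℓ)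
  (λ j → trans (cong (threshold ℓ ≤ᵇ_) (lookup∘tabulate _ j)) (stepEntry-threshold ℓ (suc (toℕ j)) N Nd≤Nu))
  where
  bound : ∀ ℓ → N ℓ ≤ l
  bound u = Nu≤l
  bound d = ≤-trans Nd≤Nu Nu≤l

stepRow-prefixAtLeast : ∀ {l} (v : Vec ℕ l) → Antitone v → (∀ j → lookup v j ≤ 2) →
  stepRow l (λ ℓ → prefixAtLeast (threshold ℓ) v) ≡ v
stepRow-prefixAtLeast v anti v≤2 = trans (tabulate-cong λ j →
    trans (cong₂ (λ b₂ b₁ → if b₂ then 2 else if b₁ then 1 else 0)
                 (sym (prefixAtLeast-threshold 2 v anti j)) (sym (prefixAtLeast-threshold 1 v anti j)))
          (levels (lookup v j) (v≤2 j)))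
  (tabulate∘lookup v)
  where
  levels : ∀ x → x ≤ 2 → (if 2 ≤ᵇ x then 2 else if 1 ≤ᵇ x then 1 else 0) ≡ x
  levels zero                _ = refl
  levels (suc zero)          _ = refl
  levels (suc (suc zero))    _ = refl
  levels (suc (suc (suc x))) (s≤s (s≤s ()))

entry-tabulate : ∀ {k l} (f : Fin k → Fin l → ℕ) i j → entry (tabulate λ i → tabulate (f i)) i j ≡ f i j
entry-tabulate f i j = trans (cong (λ row → lookup row j) (lookup∘tabulate _ i)) (lookup∘tabulate (f i) j)

stepRows-InB : ∀ {k l} (N : Fin k → Letter → ℕ) → (∀ i i' ℓ → toℕ i ≤ toℕ i' → N i' ℓ ≤ N i ℓ) →
  InB k l 2 (tabulate λ i → stepRow l (N i))
stepRows-InB {l = l} N N-antitone = record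
  { bounded = λ i j → subst (_≤ 2) (sym (entry′ i j)) (stepEntry-≤2 (suc (toℕ j)) (N i))
  ; rowDec  = λ i j j' j≤j' → subst₂ _≤_ (sym (entry′ i j')) (sym (entry′ i j))
      (stepEntry-mono {N = N i} {N' = N i} (s≤s j≤j') λ _ → ≤-refl)
  ; colDec  = λ i i' j i≤i' → subst₂ _≤_ (sym (entry′ i' j)) (sym (entry′ i j))
      (stepEntry-mono {suc (toℕ j)} {N = N i} {N' = N i'} ≤-refl λ ℓ → N-antitone i i' ℓ i≤i')
  }
  where
  entry′ : ∀ i j → entry (tabulate λ i → stepRow l (N i)) i j ≡ stepEntry (suc (toℕ j)) (N i)
  entry′ = entry-tabulate λ i j → stepEntry (suc (toℕ j)) (N i)

Bw-InB : ∀ k l w → InB k l 2 (Bw k l w)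
Bw-InB k l w = stepRows-InB (λ i ℓ → centralCount ℓ nothing (k ∸ toℕ i) w)
  (λ i i' ℓ i≤i' → centralCount-mono ℓ nothing w (∸-monoʳ-≤ k i≤i'))

Bw-runsWord : ∀ k l R →
  Bw k l (runsWord R) ≡ tabulate λ i → stepRow l (λ ℓ → centrals ℓ (take (k ∸ toℕ i) R))
Bw-runsWord k l R =
  tabulate-cong λ i → stepRow-cong λ ℓ → centralCount-runsWord ℓ nothing (k ∸ toℕ i) R refl

-- The inverse map

lookupOr : ∀ {A : Set} {n} → A → Vec A n → ℕ → A
lookupOr z []       _       = z
lookupOr z (x ∷ xs) zero    = x
lookupOr z (x ∷ xs) (suc i) = lookupOr z xs i

lookupOr-toℕ : ∀ {A : Set} {n} (z : A) (xs : Vec A n) i → lookupOr z xs (toℕ i) ≡ lookup xs i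
lookupOr-toℕ z (x ∷ xs) zero    = refl
lookupOr-toℕ z (x ∷ xs) (suc i) = lookupOr-toℕ z xs i

lookupOr-fromℕ< : ∀ {A : Set} {n} (z : A) (xs : Vec A n) i (i<n : i < n) →
  lookupOr z xs i ≡ lookup xs (fromℕ< i<n)
lookupOr-fromℕ< z xs i i<n =
  trans (cong (lookupOr z xs) (sym (toℕ-fromℕ< i<n))) (lookupOr-toℕ z xs (fromℕ< i<n))

lookupOr-out : ∀ {A : Set} {n} (z : A) (xs : Vec A n) i → n ≤ i → lookupOr z xs i ≡ z
lookupOr-out z []       i       _         = refl
lookupOr-out z (x ∷ xs) (suc i) (s≤s n≤i) = lookupOr-out z xs i n≤i

-- Row r of M counted from the bottom (row k - r from the top), padded with a row of 0's
-- at r = 0 and rows of 2's for r > k; for M = B^w, profile M ℓ r is upᵣ(w) or downᵣ(w).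
extendedRow : ∀ {k l} → Matrix k l → ℕ → Vec ℕ l
extendedRow {k} {l} M r = if k <ᵇ r then replicate l 2 else lookupOr (replicate l 0) M (k ∸ r)

profile : ∀ {k l} → Matrix k l → Letter → ℕ → ℕ
profile M ℓ r = prefixAtLeast (threshold ℓ) (extendedRow M r)

profile-zero : ∀ {k l} (M : Matrix k l) ℓ → profile M ℓ 0 ≡ 0
profile-zero {k} {l} M ℓ rewrite lookupOr-out (replicate l 0) M k ≤-refl = zeros ℓ l
  where
  zeros : ∀ ℓ l → prefixAtLeast (threshold ℓ) (replicate l 0) ≡ 0
  zeros ℓ zero    = refl
  zeros u (suc l) = refl
  zeros d (suc l) = refl

profile-top : ∀ {k l} (M : Matrix k l) ℓ r → k < r → profile M ℓ r ≡ l
profile-top {k} {l} M ℓ r k<r rewrite ≤ᵇ-true k<r = twos ℓ l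
  where
  twos : ∀ ℓ l → prefixAtLeast (threshold ℓ) (replicate l 2) ≡ l
  twos ℓ zero    = refl
  twos u (suc l) = cong suc (twos u l)
  twos d (suc l) = cong suc (twos d l)

extendedRow-row : ∀ {k l} (M : Matrix k l) i → extendedRow M (k ∸ toℕ i) ≡ lookup M i
extendedRow-row {k} {l} M i rewrite ≤ᵇ-false {suc k} {k ∸ toℕ i} (<⇒≱ (s≤s (m∸n≤m k (toℕ i)))) =
  trans (cong (lookupOr (replicate l 0) M) (m∸[m∸n]≡n (toℕ≤n i))) (lookupOr-toℕ _ M i)

module _ {k l} {M : Matrix k l} (M∈B : InB k l 2 M) where

  private
    rowOr0 : ℕ → Vec ℕ l
    rowOr0 = lookupOr (replicate l 0) M

  rowOr0-≤2 : ∀ i j → lookup (rowOr0 i) j ≤ 2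
  rowOr0-≤2 i j with i <? k
  ... | yes i<k rewrite lookupOr-fromℕ< (replicate l 0) M i i<k = InB.bounded M∈B (fromℕ< i<k) j
  ... | no  i≮k rewrite lookupOr-out (replicate l 0) M i (≮⇒≥ i≮k) | lookup-replicate j 0 = z≤n

  rowOr0-antitone : ∀ {i i'} → i ≤ i' → ∀ j → lookup (rowOr0 i') j ≤ lookup (rowOr0 i) j
  rowOr0-antitone {i} {i'} i≤i' j with i' <? k
  ... | no  i'≮k rewrite lookupOr-out (replicate l 0) M i' (≮⇒≥ i'≮k) | lookup-replicate j 0 = z≤n
  ... | yes i'<k
    rewrite lookupOr-fromℕ< (replicate l 0) M i' i'<k | lookupOr-fromℕ< (replicate l 0) M i (≤-<-trans i≤i' i'<k) =
    InB.colDec M∈B (fromℕ< (≤-<-trans i≤i' i'<k)) (fromℕ< i'<k) j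
      (subst₂ _≤_ (sym (toℕ-fromℕ< _)) (sym (toℕ-fromℕ< i'<k)) i≤i')

  extendedRow-mono : ∀ r j → lookup (extendedRow M r) j ≤ lookup (extendedRow M (suc r)) j
  extendedRow-mono r j with k <ᵇ r | <ᵇ-reflects-< k r | k <ᵇ suc r | <ᵇ-reflects-< k (suc r)
  ... | true  | _       | true  | _          = ≤-refl
  ... | true  | ofʸ k<r | false | ofⁿ k≮1+r = ⊥-elim (k≮1+r (m<n⇒m<1+n k<r))
  ... | false | _       | true  | _          rewrite lookup-replicate j 2 = rowOr0-≤2 (k ∸ r) j
  ... | false | _       | false | _          = rowOr0-antitone (∸-monoʳ-≤ k (n≤1+n r)) j

  profile-mono : ∀ ℓ r → profile M ℓ r ≤ profile M ℓ (suc r)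
  profile-mono ℓ r = prefixAtLeast-mono (threshold ℓ) (extendedRow M r) (extendedRow M (suc r)) (extendedRow-mono r)

runsFrom : (Letter → ℕ → ℕ) → ℕ → ℕ → Runs
runsFrom F s zero    = []
runsFrom F s (suc n) = (F u (suc s) ∸ F u s , F d (suc s) ∸ F d s) ∷ runsFrom F (suc s) n

length-runsFrom : ∀ F s n → length (runsFrom F s n) ≡ n
length-runsFrom F s zero    = refl
length-runsFrom F s (suc n) = cong suc (length-runsFrom F (suc s) n)

take-runsFrom : ∀ F s n r → take r (runsFrom F s n) ≡ runsFrom F s (r ⊓ n)
take-runsFrom F s n       zero    = refl
take-runsFrom F s zero    (suc r) = refl
take-runsFrom F s (suc n) (suc r) = cong (_ ∷_) (take-runsFrom F (suc s) n r)

centrals-runsFrom : ∀ ℓ F → (∀ r → F ℓ r ≤ F ℓ (suc r)) → ∀ s n →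
  F ℓ s + centrals ℓ (runsFrom F s n) ≡ F ℓ (s + n)
centrals-runsFrom ℓ F mono s zero    = trans (+-identityʳ (F ℓ s)) (cong (F ℓ) (sym (+-identityʳ s)))
centrals-runsFrom ℓ F mono s (suc n) = begin
  F ℓ s + (runLength ℓ (F u (suc s) ∸ F u s , F d (suc s) ∸ F d s) + C)
                                    ≡⟨ cong (λ x → F ℓ s + (x + C)) (runLength-Δ ℓ) ⟩
  F ℓ s + (F ℓ (suc s) ∸ F ℓ s + C) ≡⟨ sym (+-assoc (F ℓ s) _ C) ⟩
  F ℓ s + (F ℓ (suc s) ∸ F ℓ s) + C ≡⟨ cong (_+ C) (m+[n∸m]≡n (mono s)) ⟩
  F ℓ (suc s) + C                   ≡⟨ centrals-runsFrom ℓ F mono (suc s) n ⟩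
  F ℓ (suc s + n)                   ≡⟨ cong (F ℓ) (sym (+-suc s n)) ⟩
  F ℓ (s + suc n)                   ∎
  where
  open ≡-Reasoning
  C : ℕ
  C = centrals ℓ (runsFrom F (suc s) n)
  runLength-Δ : ∀ ℓ → runLength ℓ (F u (suc s) ∸ F u s , F d (suc s) ∸ F d s) ≡ F ℓ (suc s) ∸ F ℓ s
  runLength-Δ u = refl
  runLength-Δ d = refl

surjective : ∀ {k l} (M : Matrix k l) → InB k l 2 M → Σ[ R ∈ Runs ] DyckRuns k l R × Bw k l (runsWord R) ≡ M
surjective {k} {l} M M∈B = R , dyckRuns , Bw≡M
  where
  R : Runs
  R = runsFrom (profile M) 0 (suc k)

  prefixSums : ∀ ℓ r → centrals ℓ (take r R) ≡ profile M ℓ (r ⊓ suc k)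
  prefixSums ℓ r = begin
    centrals ℓ (take r R)
      ≡⟨ cong (centrals ℓ) (take-runsFrom (profile M) 0 (suc k) r) ⟩
    centrals ℓ (runsFrom (profile M) 0 (r ⊓ suc k))
      ≡⟨ cong (_+ centrals ℓ (runsFrom (profile M) 0 (r ⊓ suc k))) (sym (profile-zero M ℓ)) ⟩
    profile M ℓ 0 + centrals ℓ (runsFrom (profile M) 0 (r ⊓ suc k))
      ≡⟨ centrals-runsFrom ℓ (profile M) (profile-mono M∈B ℓ) 0 (r ⊓ suc k) ⟩
    profile M ℓ (r ⊓ suc k) ∎
    where open ≡-Reasoning

  dyckRuns : DyckRuns k l R
  dyckRuns = record
    { blocks = blocks
    ; totals = λ ℓ → begin
        centrals ℓ R                    ≡⟨ cong (centrals ℓ) (sym (take-all (suc k) R (≤-reflexive blocks))) ⟩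
        centrals ℓ (take (suc k) R)     ≡⟨ prefixSums ℓ (suc k) ⟩
        profile M ℓ (suc k ⊓ suc k)     ≡⟨ cong (profile M ℓ) (⊓-idem (suc k)) ⟩
        profile M ℓ (suc k)             ≡⟨ profile-top M ℓ (suc k) ≤-refl ⟩
        l                               ∎
    ; ballot = λ r → subst₂ _≤_ (sym (prefixSums d r)) (sym (prefixSums u r))
                                (prefixAtLeast-d≤u (extendedRow M (r ⊓ suc k)))
    }
    where
    open ≡-Reasoning
    blocks : length R ≡ suc k
    blocks = length-runsFrom (profile M) 0 (suc k)

  Bw≡M : Bw k l (runsWord R) ≡ M
  Bw≡M = trans (Bw-runsWord k l R) (trans (tabulate-cong row≡) (tabulate∘lookup M))
    where
    k∸i⊓1+k : ∀ i → (k ∸ toℕ i) ⊓ suc k ≡ k ∸ toℕ i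
    k∸i⊓1+k i = m≤n⇒m⊓n≡m (≤-trans (m∸n≤m k (toℕ i)) (n≤1+n k))
    row≡ : ∀ i → stepRow l (λ ℓ → centrals ℓ (take (k ∸ toℕ i) R)) ≡ lookup M i
    row≡ i = begin
      stepRow l (λ ℓ → centrals ℓ (take (k ∸ toℕ i) R))
        ≡⟨ stepRow-cong (λ ℓ → trans (prefixSums ℓ (k ∸ toℕ i)) (cong (profile M ℓ) (k∸i⊓1+k i))) ⟩
      stepRow l (λ ℓ → profile M ℓ (k ∸ toℕ i))
        ≡⟨ stepRow-cong (λ ℓ → cong (prefixAtLeast (threshold ℓ)) (extendedRow-row M i)) ⟩
      stepRow l (λ ℓ → prefixAtLeast (threshold ℓ) (lookup M i))
        ≡⟨ stepRow-prefixAtLeast (lookup M i) (InB.rowDec M∈B i) (InB.bounded M∈B i) ⟩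
      lookup M i ∎
      where open ≡-Reasoning

prefixSums-injective : ∀ R R' → length R ≡ length R' →
  (∀ ℓ r → centrals ℓ (take r R) ≡ centrals ℓ (take r R')) → R ≡ R'
prefixSums-injective []            []              _       _     = refl
prefixSums-injective ((a , b) ∷ R) ((a' , b') ∷ R') length≡ sums≡ =
  cong₂ _∷_ (cong₂ _,_ (head≡ u) (head≡ d)) (prefixSums-injective R R' (suc-injective length≡) λ ℓ r →
    +-cancelˡ-≡ (runLength ℓ (a , b)) _ _ (trans (sums≡ ℓ (suc r)) (cong (_+ _) (sym (head≡ ℓ)))))
  where
  head≡ : ∀ ℓ → runLength ℓ (a , b) ≡ runLength ℓ (a' , b')
  head≡ ℓ = +-cancelʳ-≡ 0 _ _ (sums≡ ℓ 1)

rowIndex : ∀ {k} r → suc r ≤ k → Σ[ i ∈ Fin k ] k ∸ toℕ i ≡ suc r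
rowIndex {k} r 1+r≤k = fromℕ< k∸1+r<k , trans (cong (k ∸_) (toℕ-fromℕ< k∸1+r<k)) (m∸[m∸n]≡n 1+r≤k)
  where
  k∸1+r<k : k ∸ suc r < k
  k∸1+r<k = ∸-monoʳ-< {k} {suc r} {0} (s≤s z≤n) 1+r≤k

module _ {k l R} (DR : DyckRuns k l R) where

  profile-Bw-row : ∀ ℓ i →
    profile (Bw k l (runsWord R)) ℓ (k ∸ toℕ i) ≡ centrals ℓ (take (k ∸ toℕ i) R)
  profile-Bw-row ℓ i = begin
    profile (Bw k l (runsWord R)) ℓ (k ∸ toℕ i)
      ≡⟨ cong (prefixAtLeast (threshold ℓ)) (extendedRow-row (Bw k l (runsWord R)) i) ⟩
    prefixAtLeast (threshold ℓ) (lookup (Bw k l (runsWord R)) i)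
      ≡⟨ cong (λ M → prefixAtLeast (threshold ℓ) (lookup M i)) (Bw-runsWord k l R) ⟩
    prefixAtLeast (threshold ℓ) (lookup (tabulate λ i → stepRow l (N i)) i)
      ≡⟨ cong (prefixAtLeast (threshold ℓ)) (lookup∘tabulate (λ i → stepRow l (N i)) i) ⟩
    prefixAtLeast (threshold ℓ) (stepRow l (N i))
      ≡⟨ prefixAtLeast-stepRow (N i) (DyckRuns.ballot DR (k ∸ toℕ i)) N-u≤l ℓ ⟩
    N i ℓ ∎
    where
    open ≡-Reasoning
    N : Fin k → Letter → ℕ
    N i ℓ = centrals ℓ (take (k ∸ toℕ i) R)
    N-u≤l : N i u ≤ l
    N-u≤l = ≤-trans (centrals-take-≤ u (k ∸ toℕ i) R) (≤-reflexive (DyckRuns.totals DR u))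

  profile-Bw : ∀ ℓ r → profile (Bw k l (runsWord R)) ℓ r ≡ centrals ℓ (take r R)
  profile-Bw ℓ zero = profile-zero (Bw k l (runsWord R)) ℓ
  profile-Bw ℓ (suc r) with k <? suc r
  ... | yes k<1+r = begin
    profile (Bw k l (runsWord R)) ℓ (suc r) ≡⟨ profile-top (Bw k l (runsWord R)) ℓ (suc r) k<1+r ⟩
    l                                        ≡⟨ sym (DyckRuns.totals DR ℓ) ⟩
    centrals ℓ R                             ≡⟨ cong (centrals ℓ) (sym (take-all (suc r) R length≤1+r)) ⟩
    centrals ℓ (take (suc r) R)              ∎
    where
    open ≡-Reasoning
    length≤1+r : length R ≤ suc r
    length≤1+r = ≤-trans (≤-reflexive (DyckRuns.blocks DR)) k<1+r
  ... | no  k≮1+r = let (i , k∸i≡1+r) = rowIndex r (≮⇒≥ k≮1+r) in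
    subst (λ r → profile (Bw k l (runsWord R)) ℓ r ≡ centrals ℓ (take r R)) k∸i≡1+r (profile-Bw-row ℓ i)

injective : ∀ {k l R R'} → DyckRuns k l R → DyckRuns k l R' →
  Bw k l (runsWord R) ≡ Bw k l (runsWord R') → R ≡ R'
injective {R = R} {R'} DR DR' Bw≡ =
  prefixSums-injective R R' (trans (DyckRuns.blocks DR) (sym (DyckRuns.blocks DR'))) λ ℓ r →
    trans (sym (profile-Bw DR ℓ r)) (trans (cong (λ M → profile M ℓ r) Bw≡) (profile-Bw DR' ℓ r))

theorem3p11 : (k m : ℕ) → 1 ≤ k → k ≤ m →
    ((w : Word) → InD (suc m) (suc k) w → InB k (m ∸ k) 2 (Bw k (m ∸ k) w))
    × ((w w' : Word) → InD (suc m) (suc k) w → InD (suc m) (suc k) w' →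
        Bw k (m ∸ k) w ≡ Bw k (m ∸ k) w' → w ≡ w')
    × ((M : Matrix k (m ∸ k)) → InB k (m ∸ k) 2 M →
        Σ[ w ∈ Word ] (InD (suc m) (suc k) w × Bw k (m ∸ k) w ≡ M))
theorem3p11 k m _ k≤m = (λ w _ → Bw-InB k (m ∸ k) w) , injectiveOnD , surjectiveOntoB
  where
  injectiveOnD : ∀ w w' → InD (suc m) (suc k) w → InD (suc m) (suc k) w' →
    Bw k (m ∸ k) w ≡ Bw k (m ∸ k) w' → w ≡ w'
  injectiveOnD w w' w∈D w'∈D Bw≡ with InD⇒DyckRuns w∈D | InD⇒DyckRuns w'∈D
  ... | R , refl , DR | R' , refl , DR' = cong runsWord (injective DR DR' Bw≡)

  surjectiveOntoB : ∀ M → InB k (m ∸ k) 2 M → Σ[ w ∈ Word ] (InD (suc m) (suc k) w × Bw k (m ∸ k) w ≡ M)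
  surjectiveOntoB M M∈B = let (R , DR , Bw≡M) = surjective M M∈B in
    runsWord R , DyckRuns⇒InD k≤m DR , Bw≡M
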